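{- Let $N\ge 1$ and let $a$ be a positive integer. If $2a\le 2^N$ then $(a,a)$ is fit in $Q_N$; if $2a+1\le 2^N$ then $(a,a+1)$ is fit in $Q_N$; if $a\ge 2$ and $2a-1\le 2^N$ then $(a,a-1)$ is fit in $Q_N$. Furthermore, if $(a,b)$ is fit in $Q_N$, then $(2a,2b)$ is fit in $Q_{N+1}$.
   Context: $Q_N=\{0,1\}^N$ is the hypercube graph (binary strings $x_0\ldots x_{N-1}$, adjacent iff differing in exactly one digit) with automorphism group $\mathrm{Aut}(Q_N)$; strings are identified with integers $\sum_i x_i2^{N-1-i}$ and, for $0\le k\le 2^N$, $I_k\subseteq Q_N$ is the set of strings with value $<k$. A pair of positive integers $(a,b)$ with $a+b\le 2^N$ is fit in $Q_N$ if there exist $g_1,g_2\in\mathrm{Aut}(Q_N)$ with $g_1(I_a)\cup g_2(I_b)=I_{a+b}$, and unfit otherwise. -}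

module Defs where

open import Data.Nat using (ℕ; zero; suc; _+_; _*_; _^_; _<_; _≤_)
open import Data.Bool using (Bool; true; false; if_then_else_)
open import Data.Vec using (Vec; []; _∷_)
open import Data.Product using (Σ; _×_; _,_)
open import Data.Sum using (_⊎_)
open import Relation.Binary.PropositionalEquality using (_≡_)

Q : ℕ → Set
Q N = Vec Bool N

dist : ∀ {N} → Q N → Q N → ℕ
dist [] [] = 0
dist (x ∷ xs) (y ∷ ys) = (if x Data.Bool.xor y then 1 else 0) + dist xs ys

Adj : ∀ {N} → Q N → Q N → Set
Adj x y = dist x y ≡ 1

bit : Bool → ℕ
bit true = 1
bit false = 0

val : ∀ {N} → Q N → ℕ
val {zero} [] = 0
val {suc N} (x ∷ xs) = bit x * 2 ^ N + val xs

I : ∀ {N} → ℕ → Q N → Set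
I k x = val x < k

record Aut (N : ℕ) : Set where
  field
    to      : Q N → Q N
    from    : Q N → Q N
    to-from : ∀ y → to (from y) ≡ y
    from-to : ∀ x → from (to x) ≡ x
    adj     : ∀ x y → (Adj x y → Adj (to x) (to y)) × (Adj (to x) (to y) → Adj x y)

open Aut public

Image : ∀ {N} → Aut N → (Q N → Set) → Q N → Set
Image g S y = Σ (Q _) λ x → S x × to g x ≡ y

Fit : ℕ → ℕ → ℕ → Set
Fit N a b =
  (1 ≤ a) × (1 ≤ b) × (a + b ≤ 2 ^ N) ×
  Σ (Aut N) λ g₁ → Σ (Aut N) λ g₂ →
    ∀ y → ((Image g₁ (I a) y ⊎ Image g₂ (I b) y) → I (a + b) y)
        × (I (a + b) y → (Image g₁ (I a) y ⊎ Image g₂ (I b) y))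

-- Read a string x₀ … x_N from its last digit: its value is x_N + 2 · val (x₀ … x_{N-1}).
-- Hence I_n consists of the strings p0 with p ∈ I_⌈n/2⌉ and p1 with p ∈ I_⌊n/2⌋. When
-- n ≤ 2^(N+1), I_⌈n/2⌉ and I_⌊n/2⌋ only contain strings 0p, and the cyclic shift
-- x₀x₁…x_N ↦ x₁…x_N x₀ (resp. x₁…x_N (1 − x₀)) maps them onto these two halves, so
-- (⌈n/2⌉, ⌊n/2⌋) is fit; n = 2a, 2a + 1, 2a − 1 give the three cases. For the doubling,
-- I_2k = I_k × Q_1, so an automorphism g of Q_N acting on the first N digits of Q_(N+1)
-- maps I_2a onto g(I_a) × Q_1.
module Submission where

open import Defs
open import Data.Nat using (ℕ; _+_; _*_; _^_; _≤_; _∸_)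
open import Data.Product using (_×_)

open import Algebra.Properties.CommutativeSemigroup using (x∙yz≈y∙xz)
open import Data.Bool using (Bool; true; false; not; _xor_; if_then_else_)
open import Data.Bool.Properties using (xor-assoc; xor-same)
open import Data.Empty using (⊥-elim)
open import Data.Nat using (suc; _<_; ⌊_/2⌋; ⌈_/2⌉; s≤s; s≤s⁻¹)
open import Data.Nat.Properties
  using (+-identityʳ; +-comm; +-commutativeSemigroup; *-suc; *-distribˡ-+; *-monoʳ-≤; +-mono-≤;
         ≤-trans; m≤m+n; m≤n*m; <⇒≱; suc-injective; module ≤-Reasoning;
         ⌊n/2⌋-mono; ⌈n/2⌉-mono; ⌊n/2⌋≤⌈n/2⌉; ⌊n/2⌋+⌈n/2⌉≡n; n≡⌊n+n/2⌋; n≡⌈n+n/2⌉)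
open import Data.Nat.Tactic.RingSolver using (solve-∀)
open import Data.Product using (Σ; _,_; uncurry)
open import Data.Sum using (_⊎_; inj₁; inj₂; [_,_]′; swap)
open import Data.Sum.Function.Propositional using (_⊎-⇔_)
open import Data.Vec using ([]; _∷_; _∷ʳ_; init; last; initLast)
open import Data.Vec.Properties using (init-∷ʳ; last-∷ʳ)
open import Function using (_∘_; id)
open import Function.Bundles using (_⇔_; mk⇔; Equivalence)
import Function.Properties.Equivalence as ⇔
open import Level using (0ℓ)
open import Relation.Nullary using (¬_)
open import Relation.Binary.PropositionalEquality
  using (_≡_; refl; sym; trans; cong; cong₂; subst; subst₂; module ≡-Reasoning)
import Relation.Binary.Reasoning.Setoid as SetoidReasoning

module ⇔-Reasoning = SetoidReasoning (⇔.⇔-setoid 0ℓ)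

⇔⇒× : ∀ {A B : Set} → A ⇔ B → (A → B) × (B → A)
⇔⇒× A⇔B = Equivalence.to A⇔B , Equivalence.from A⇔B

2*n≡n+n : ∀ n → 2 * n ≡ n + n
2*n≡n+n n = cong (n +_) (+-identityʳ n)

2*m≤n⇔m≤⌊n/2⌋ : ∀ m n → 2 * m ≤ n ⇔ m ≤ ⌊ n /2⌋
2*m≤n⇔m≤⌊n/2⌋ m n = mk⇔ halve double
  where
  open ≤-Reasoning
  halve : 2 * m ≤ n → m ≤ ⌊ n /2⌋
  halve 2m≤n = begin
    m             ≡⟨ n≡⌊n+n/2⌋ m ⟩
    ⌊ m + m /2⌋   ≤⟨ ⌊n/2⌋-mono (subst (_≤ n) (2*n≡n+n m) 2m≤n) ⟩
    ⌊ n /2⌋       ∎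
  double : m ≤ ⌊ n /2⌋ → 2 * m ≤ n
  double m≤⌊n/2⌋ = begin
    2 * m               ≡⟨ 2*n≡n+n m ⟩
    m + m               ≤⟨ +-mono-≤ m≤⌊n/2⌋ (≤-trans m≤⌊n/2⌋ (⌊n/2⌋≤⌈n/2⌉ n)) ⟩
    ⌊ n /2⌋ + ⌈ n /2⌉   ≡⟨ ⌊n/2⌋+⌈n/2⌉≡n n ⟩
    n                   ∎

2+2*m≤n⇔m<⌊n/2⌋ : ∀ m n → 2 + 2 * m ≤ n ⇔ m < ⌊ n /2⌋
2+2*m≤n⇔m<⌊n/2⌋ m n =
  subst (λ j → j ≤ n ⇔ m < ⌊ n /2⌋) (*-suc 2 m) (2*m≤n⇔m≤⌊n/2⌋ (suc m) n)

-- half c n is the number of v < n whose parity is bit c.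
half : Bool → ℕ → ℕ
half false n = ⌈ n /2⌉
half true  n = ⌊ n /2⌋

bit+2*m<n⇔m<half : ∀ c m n → bit c + 2 * m < n ⇔ m < half c n
bit+2*m<n⇔m<half false m n = ⇔.trans (mk⇔ s≤s s≤s⁻¹) (2+2*m≤n⇔m<⌊n/2⌋ m (suc n))
bit+2*m<n⇔m<half true  m n = 2+2*m≤n⇔m<⌊n/2⌋ m n

half-double : ∀ c n → half c (2 * n) ≡ n
half-double false n = trans (cong ⌈_/2⌉ (2*n≡n+n n)) (sym (n≡⌈n+n/2⌉ n))
half-double true  n = trans (cong ⌊_/2⌋ (2*n≡n+n n)) (sym (n≡⌊n+n/2⌋ n))

val-∷ʳ : ∀ {N} (xs : Q N) c → val (xs ∷ʳ c) ≡ bit c + 2 * val xs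
val-∷ʳ []      true  = refl
val-∷ʳ []      false = refl
val-∷ʳ {suc N} (x ∷ xs) c = begin
  bit x * (2 * 2 ^ N) + val (xs ∷ʳ c)         ≡⟨ cong (bit x * (2 * 2 ^ N) +_) (val-∷ʳ xs c) ⟩
  bit x * (2 * 2 ^ N) + (bit c + 2 * val xs)  ≡⟨ regroup (bit x) (2 ^ N) (bit c) (val xs) ⟩
  bit c + 2 * (bit x * 2 ^ N + val xs)        ∎
  where
  open ≡-Reasoning
  regroup : ∀ b K c v → b * (2 * K) + (c + 2 * v) ≡ c + 2 * (b * K + v)
  regroup = solve-∀

I-∷ʳ⇔ : ∀ {N} k (xs : Q N) c → I k (xs ∷ʳ c) ⇔ val xs < half c k
I-∷ʳ⇔ k xs c = subst (λ v → v < k ⇔ val xs < half c k) (sym (val-∷ʳ xs c))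
                     (bit+2*m<n⇔m<half c (val xs) k)

I-2*-∷ʳ⇔ : ∀ {N} k (xs : Q N) c → I (2 * k) (xs ∷ʳ c) ⇔ I k xs
I-2*-∷ʳ⇔ k xs c =
  subst (λ h → I (2 * k) (xs ∷ʳ c) ⇔ val xs < h) (half-double c k) (I-∷ʳ⇔ (2 * k) xs c)

¬I-true∷ : ∀ {M k} (x : Q M) → k ≤ 2 ^ M → ¬ I k (true ∷ x)
¬I-true∷ {M} x k≤2^M x∈I =
  <⇒≱ x∈I (≤-trans k≤2^M (≤-trans (m≤n*m (2 ^ M) 1) (m≤m+n _ (val x))))

∀-∷ʳ : ∀ {N} {P : Q (suc N) → Set} → (∀ xs c → P (xs ∷ʳ c)) → ∀ y → P y
∀-∷ʳ p y with initLast y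
... | xs , c , refl = p xs c

dist-refl : ∀ {N} (x : Q N) → dist x x ≡ 0
dist-refl []          = refl
dist-refl (true  ∷ x) = dist-refl x
dist-refl (false ∷ x) = dist-refl x

dist≡0⇒≡ : ∀ {N} (x y : Q N) → dist x y ≡ 0 → x ≡ y
dist≡0⇒≡ []          []          _   = refl
dist≡0⇒≡ (true  ∷ x) (true  ∷ y) d≡0 = cong (true ∷_) (dist≡0⇒≡ x y d≡0)
dist≡0⇒≡ (false ∷ x) (false ∷ y) d≡0 = cong (false ∷_) (dist≡0⇒≡ x y d≡0)
dist≡0⇒≡ (true  ∷ x) (false ∷ y) ()
dist≡0⇒≡ (false ∷ x) (true  ∷ y) ()

-- Adj (c ∷ x) (not c ∷ y) unfolds to the left-hand side.
suc[dist]≡1⇔≡ : ∀ {N} (x y : Q N) → suc (dist x y) ≡ 1 ⇔ x ≡ y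
suc[dist]≡1⇔≡ x y = mk⇔ (dist≡0⇒≡ x y ∘ suc-injective) λ { refl → cong suc (dist-refl x) }

dist-∷ʳ : ∀ {N} (xs ys : Q N) a b → dist (xs ∷ʳ a) (ys ∷ʳ b) ≡ dist (a ∷ xs) (b ∷ ys)
dist-∷ʳ []       []       a b = refl
dist-∷ʳ (x ∷ xs) (y ∷ ys) a b =
  trans (cong (δ x y +_) (dist-∷ʳ xs ys a b))
        (x∙yz≈y∙xz +-commutativeSemigroup (δ x y) (δ a b) (dist xs ys))
  where
  δ : Bool → Bool → ℕ
  δ u v = if u xor v then 1 else 0

dist-xor-∷ : ∀ {N} s x y (xs ys : Q N) → dist ((s xor x) ∷ xs) ((s xor y) ∷ ys) ≡ dist (x ∷ xs) (y ∷ ys)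
dist-xor-∷ false x     y     xs ys = refl
dist-xor-∷ true  true  true  xs ys = refl
dist-xor-∷ true  true  false xs ys = refl
dist-xor-∷ true  false true  xs ys = refl
dist-xor-∷ true  false false xs ys = refl

xor-cancelˡ : ∀ s c → s xor (s xor c) ≡ c
xor-cancelˡ s c = trans (sym (xor-assoc s s c)) (cong (_xor c) (xor-same s))

isometry⇒Aut : ∀ {N} (f g : Q N → Q N) → (∀ y → f (g y) ≡ y) → (∀ x → g (f x) ≡ x) →
               (∀ x y → dist (f x) (f y) ≡ dist x y) → Aut N
isometry⇒Aut f g f∘g g∘f isometry = record
  { to = f ; from = g ; to-from = f∘g ; from-to = g∘f
  ; adj = λ x y → ⇔⇒× (subst (λ d → d ≡ 1 ⇔ dist (f x) (f y) ≡ 1) (isometry x y) ⇔.refl)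
  }

rotate : ∀ {M} → Bool → Aut (suc M)
rotate s = isometry⇒Aut shift unshift shift∘unshift unshift∘shift isometry
  where
  shift : ∀ {M} → Q (suc M) → Q (suc M)
  shift (x ∷ xs) = xs ∷ʳ (s xor x)
  unshift : ∀ {M} → Q (suc M) → Q (suc M)
  unshift y = (s xor last y) ∷ init y
  shift∘unshift : ∀ y → shift (unshift y) ≡ y
  shift∘unshift = ∀-∷ʳ λ xs c →
    cong₂ _∷ʳ_ (init-∷ʳ c xs) (trans (cong (s xor_) (cong (s xor_) (last-∷ʳ c xs))) (xor-cancelˡ s c))
  unshift∘shift : ∀ x → unshift (shift x) ≡ x
  unshift∘shift (x ∷ xs) =
    cong₂ _∷_ (trans (cong (s xor_) (last-∷ʳ (s xor x) xs)) (xor-cancelˡ s x)) (init-∷ʳ (s xor x) xs)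
  isometry : ∀ x y → dist (shift x) (shift y) ≡ dist x y
  isometry (x ∷ xs) (y ∷ ys) = trans (dist-∷ʳ xs ys (s xor x) (s xor y)) (dist-xor-∷ s x y xs ys)

from-rotate : ∀ {M} s (xs : Q M) c → from (rotate s) (xs ∷ʳ c) ≡ (s xor c) ∷ xs
from-rotate s xs c = cong₂ _∷_ (cong (s xor_) (last-∷ʳ c xs)) (init-∷ʳ c xs)

infixr 9 _∘ᴬ_
infix 10 _⁻¹ᴬ

_∘ᴬ_ : ∀ {N} → Aut N → Aut N → Aut N
g ∘ᴬ f = record
  { to      = to g ∘ to f
  ; from    = from f ∘ from g
  ; to-from = λ y → trans (cong (to g) (to-from f (from g y))) (to-from g y)
  ; from-to = λ x → trans (cong (from f) (from-to g (to f x))) (from-to f x)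
  ; adj     = λ x y → let (f⁺ , f⁻) = adj f x y
                          (g⁺ , g⁻) = adj g (to f x) (to f y)
                      in g⁺ ∘ f⁺ , f⁻ ∘ g⁻
  }

_⁻¹ᴬ : ∀ {N} → Aut N → Aut N
g ⁻¹ᴬ = record
  { to = from g ; from = to g ; to-from = from-to g ; from-to = to-from g
  ; adj = λ x y → let (g⁺ , g⁻) = adj g (from g x) (from g y)
                      cancel    = subst₂ Adj (to-from g x) (to-from g y)
                      uncancel  = subst₂ Adj (sym (to-from g x)) (sym (to-from g y))
                  in g⁻ ∘ uncancel , cancel ∘ g⁺
  }

to-injective⇔ : ∀ {N} (g : Aut N) {x y} → x ≡ y ⇔ to g x ≡ to g y
to-injective⇔ g {x} {y} = mk⇔ (cong (to g)) λ gx≡gy →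
  trans (sym (from-to g x)) (trans (cong (from g) gx≡gy) (from-to g y))

lift : ∀ {N} → Aut N → Aut (suc N)
lift g = record
  { to      = λ { (c ∷ x) → c ∷ to g x }
  ; from    = λ { (c ∷ x) → c ∷ from g x }
  ; to-from = λ { (c ∷ x) → cong (c ∷_) (to-from g x) }
  ; from-to = λ { (c ∷ x) → cong (c ∷_) (from-to g x) }
  ; adj     = λ { (c ∷ x) (c′ ∷ x′) → adj-lift c c′ x x′ }
  }
  where
  first-digits-differ : ∀ x x′ → suc (dist x x′) ≡ 1 ⇔ suc (dist (to g x) (to g x′)) ≡ 1
  first-digits-differ x x′ =
    ⇔.trans (suc[dist]≡1⇔≡ x x′) (⇔.trans (to-injective⇔ g) (⇔.sym (suc[dist]≡1⇔≡ _ _)))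
  adj-lift : ∀ c c′ x x′ → (Adj (c ∷ x) (c′ ∷ x′) → Adj (c ∷ to g x) (c′ ∷ to g x′))
                         × (Adj (c ∷ to g x) (c′ ∷ to g x′) → Adj (c ∷ x) (c′ ∷ x′))
  adj-lift true  true  = adj g
  adj-lift false false = adj g
  adj-lift true  false x x′ = ⇔⇒× (first-digits-differ x x′)
  adj-lift false true  x x′ = ⇔⇒× (first-digits-differ x x′)

-- Conjugating by the cyclic shift, double g acts by g on all digits but the last.
double : ∀ {N} → Aut N → Aut (suc N)
double g = rotate false ∘ᴬ lift g ∘ᴬ rotate false ⁻¹ᴬ

from-double : ∀ {N} (g : Aut N) xs c → from (double g) (xs ∷ʳ c) ≡ from g xs ∷ʳ c
from-double g xs c = cong (to (rotate false) ∘ from (lift g)) (from-rotate false xs c)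

Image⇔preimage : ∀ {N} (g : Aut N) (S : Q N → Set) y → Image g S y ⇔ S (from g y)
Image⇔preimage g S y = mk⇔
  (λ { (x , x∈S , gx≡y) → subst S (trans (sym (from-to g x)) (cong (from g) gx≡y)) x∈S })
  (λ y′∈S → from g y , y′∈S , to-from g y)

Splits : ∀ N → ℕ → ℕ → Aut N → Aut N → Set
Splits N a b g₁ g₂ = ∀ y → (I a (from g₁ y) ⊎ I b (from g₂ y)) ⇔ I (a + b) y

Splits⇒Fit : ∀ {N a b} → 1 ≤ a → 1 ≤ b → a + b ≤ 2 ^ N →
             (g₁ g₂ : Aut N) → Splits N a b g₁ g₂ → Fit N a b
Splits⇒Fit {a = a} {b} 1≤a 1≤b a+b≤2^N g₁ g₂ splits =
  1≤a , 1≤b , a+b≤2^N , g₁ , g₂ , λ y →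
  ⇔⇒× (⇔.trans (Image⇔preimage g₁ (I a) y ⊎-⇔ Image⇔preimage g₂ (I b) y) (splits y))

Fit⇒Splits : ∀ {N a b} → Fit N a b → Σ (Aut N) λ g₁ → Σ (Aut N) λ g₂ → Splits N a b g₁ g₂
Fit⇒Splits {a = a} {b} (_ , _ , _ , g₁ , g₂ , fit) = g₁ , g₂ , λ y →
  ⇔.trans (⇔.sym (Image⇔preimage g₁ (I a) y ⊎-⇔ Image⇔preimage g₂ (I b) y)) (uncurry mk⇔ (fit y))

Fit-sym : ∀ {N a b} → Fit N a b → Fit N b a
Fit-sym {N} {a} {b} fit@(1≤a , 1≤b , a+b≤2^N , _) with Fit⇒Splits fit
... | g₁ , g₂ , splits =
  Splits⇒Fit 1≤b 1≤a (subst (_≤ 2 ^ N) (+-comm a b) a+b≤2^N) g₂ g₁ λ y →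
    subst (λ k → (I b (from g₂ y) ⊎ I a (from g₁ y)) ⇔ I k y) (+-comm a b)
          (⇔.trans (mk⇔ swap swap) (splits y))

Fit-halves : ∀ M n → 2 ≤ n → n ≤ 2 ^ suc M → Fit (suc M) ⌈ n /2⌉ ⌊ n /2⌋
Fit-halves M n 2≤n n≤2^[1+M] =
  Splits⇒Fit 1≤⌈n/2⌉ 1≤⌊n/2⌋ (subst (_≤ 2 ^ suc M) (sym ⌈n/2⌉+⌊n/2⌋≡n) n≤2^[1+M])
             (rotate false) (rotate true) splits
  where
  1≤⌊n/2⌋ : 1 ≤ ⌊ n /2⌋
  1≤⌊n/2⌋ = Equivalence.to (2*m≤n⇔m≤⌊n/2⌋ 1 n) 2≤n
  1≤⌈n/2⌉ : 1 ≤ ⌈ n /2⌉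
  1≤⌈n/2⌉ = ≤-trans 1≤⌊n/2⌋ (⌊n/2⌋≤⌈n/2⌉ n)
  ⌈n/2⌉+⌊n/2⌋≡n : ⌈ n /2⌉ + ⌊ n /2⌋ ≡ n
  ⌈n/2⌉+⌊n/2⌋≡n = trans (+-comm ⌈ n /2⌉ ⌊ n /2⌋) (⌊n/2⌋+⌈n/2⌉≡n n)
  ⌈n/2⌉≤2^M : ⌈ n /2⌉ ≤ 2 ^ M
  ⌈n/2⌉≤2^M = subst (⌈ n /2⌉ ≤_) (half-double false (2 ^ M)) (⌈n/2⌉-mono n≤2^[1+M])
  ⌊n/2⌋≤2^M : ⌊ n /2⌋ ≤ 2 ^ M
  ⌊n/2⌋≤2^M = ≤-trans (⌊n/2⌋≤⌈n/2⌉ n) ⌈n/2⌉≤2^M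
  by-last-digit : ∀ xs c → (I ⌈ n /2⌉ (c ∷ xs) ⊎ I ⌊ n /2⌋ (not c ∷ xs)) ⇔ val xs < half c n
  by-last-digit xs false = mk⇔ [ id , ⊥-elim ∘ ¬I-true∷ xs ⌊n/2⌋≤2^M ]′ inj₁
  by-last-digit xs true  = mk⇔ [ ⊥-elim ∘ ¬I-true∷ xs ⌈n/2⌉≤2^M , id ]′ inj₂
  splits : Splits (suc M) ⌈ n /2⌉ ⌊ n /2⌋ (rotate false) (rotate true)
  splits = ∀-∷ʳ λ xs c → begin
    (I ⌈ n /2⌉ (from (rotate false) (xs ∷ʳ c)) ⊎ I ⌊ n /2⌋ (from (rotate true) (xs ∷ʳ c)))
      ≡⟨ cong₂ (λ u v → I ⌈ n /2⌉ u ⊎ I ⌊ n /2⌋ v) (from-rotate false xs c) (from-rotate true xs c) ⟩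
    (I ⌈ n /2⌉ (c ∷ xs) ⊎ I ⌊ n /2⌋ (not c ∷ xs))  ≈⟨ by-last-digit xs c ⟩
    val xs < half c n                               ≈⟨ ⇔.sym (I-∷ʳ⇔ n xs c) ⟩
    I n (xs ∷ʳ c)                                   ≡⟨ cong (λ k → I k (xs ∷ʳ c)) (sym ⌈n/2⌉+⌊n/2⌋≡n) ⟩
    I (⌈ n /2⌉ + ⌊ n /2⌋) (xs ∷ʳ c)                 ∎
    where open ⇔-Reasoning

Fit[a,a] : ∀ M a → 1 ≤ a → 2 * a ≤ 2 ^ suc M → Fit (suc M) a a
Fit[a,a] M a 1≤a 2a≤2^[1+M] =
  subst₂ (Fit (suc M)) (half-double false a) (half-double true a)
         (Fit-halves M (2 * a) (*-monoʳ-≤ 2 1≤a) 2a≤2^[1+M])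

Fit[1+a,a] : ∀ M a → 1 ≤ a → suc (2 * a) ≤ 2 ^ suc M → Fit (suc M) (suc a) a
Fit[1+a,a] M a 1≤a 1+2a≤2^[1+M] =
  subst₂ (λ u v → Fit (suc M) (suc u) v) (half-double true a) (half-double false a)
         (Fit-halves M (suc (2 * a)) (s≤s (≤-trans 1≤a (m≤m+n a _))) 1+2a≤2^[1+M])

Fit-double : ∀ {N a b} → Fit N a b → Fit (suc N) (2 * a) (2 * b)
Fit-double {N} {a} {b} fit@(1≤a , 1≤b , a+b≤2^N , _) with Fit⇒Splits fit
... | g₁ , g₂ , splits =
  Splits⇒Fit (≤-trans 1≤a (m≤m+n a _)) (≤-trans 1≤b (m≤m+n b _)) 2a+2b≤2^[1+N]
             (double g₁) (double g₂) (∀-∷ʳ doubled)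
  where
  2a+2b≤2^[1+N] : 2 * a + 2 * b ≤ 2 * 2 ^ N
  2a+2b≤2^[1+N] = subst (_≤ 2 * 2 ^ N) (*-distribˡ-+ 2 a b) (*-monoʳ-≤ 2 a+b≤2^N)
  doubled : ∀ xs c → (I (2 * a) (from (double g₁) (xs ∷ʳ c)) ⊎ I (2 * b) (from (double g₂) (xs ∷ʳ c)))
                   ⇔ I (2 * a + 2 * b) (xs ∷ʳ c)
  doubled xs c = begin
    (I (2 * a) (from (double g₁) (xs ∷ʳ c)) ⊎ I (2 * b) (from (double g₂) (xs ∷ʳ c)))
      ≡⟨ cong₂ (λ u v → I (2 * a) u ⊎ I (2 * b) v) (from-double g₁ xs c) (from-double g₂ xs c) ⟩
    (I (2 * a) (from g₁ xs ∷ʳ c) ⊎ I (2 * b) (from g₂ xs ∷ʳ c))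
      ≈⟨ I-2*-∷ʳ⇔ a (from g₁ xs) c ⊎-⇔ I-2*-∷ʳ⇔ b (from g₂ xs) c ⟩
    (I a (from g₁ xs) ⊎ I b (from g₂ xs))  ≈⟨ splits xs ⟩
    I (a + b) xs                            ≈⟨ ⇔.sym (I-2*-∷ʳ⇔ (a + b) xs c) ⟩
    I (2 * (a + b)) (xs ∷ʳ c)               ≡⟨ cong (λ k → I k (xs ∷ʳ c)) (*-distribˡ-+ 2 a b) ⟩
    I (2 * a + 2 * b) (xs ∷ʳ c)             ∎
    where open ⇔-Reasoning

mainTheorem17 : ∀ (N a : ℕ) → 1 ≤ N → 1 ≤ a →
    (2 * a ≤ 2 ^ N → Fit N a a)
    × (2 * a + 1 ≤ 2 ^ N → Fit N a (a + 1))
    × (2 ≤ a → 2 * a ∸ 1 ≤ 2 ^ N → Fit N a (a ∸ 1))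
    × (∀ (b : ℕ) → Fit N a b → Fit (N + 1) (2 * a) (2 * b))
mainTheorem17 (suc M) a _ 1≤a =
    Fit[a,a] M a 1≤a
  , (λ 2a+1≤2^N → subst (Fit (suc M) a) (+-comm 1 a) (Fit-sym
       (Fit[1+a,a] M a 1≤a (subst (_≤ 2 ^ suc M) (+-comm (2 * a) 1) 2a+1≤2^N))))
  , (λ { (s≤s 1≤a∸1) 2a∸1≤2^N →
       Fit[1+a,a] M _ 1≤a∸1 (subst (_≤ 2 ^ suc M) (cong (_∸ 1) (*-suc 2 _)) 2a∸1≤2^N) })
  , λ b fit → subst (λ N → Fit N (2 * a) (2 * b)) (+-comm 1 (suc M)) (Fit-double fit)
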